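{- Let $\mathcal{J}$ be a finite set of jobs, each $j\in\mathcal{J}$ with a positive integer processing time $p_j$ and a nondecreasing cost function $f_j:\{1,2,\dots\}\to\mathbb{Z}_{\ge 0}$. Let $T=\sum_{j\in\mathcal{J}}p_j$, $\mathcal{T}=\{1,\dots,T\}$, and for $t\in\mathcal{T}$, $A\subseteq\mathcal{J}$ let $D(t)=T-t+1$, $D(t,A)=\max\{D(t)-\sum_{j\in A}p_j,0\}$, $p_j(t,A)=\min\{p_j,D(t,A)\}$. Let $x\in\{0,1\}^{\mathcal{J}\times\mathcal{T}}$ satisfy $\sum_{j\notin A}\sum_{s\in\mathcal{T}:s\ge t}p_j(t,A)x_{js}\ge D(t,A)$ for all $t\in\mathcal{T}$, $A\subseteq\mathcal{J}$, and $\sum_{t\in\mathcal{T}}x_{jt}=1$ for all $j\in\mathcal{J}$. For each job $j$ let $d_j$ be the unique $t$ with $x_{jt}=1$, and let the EDD schedule be the schedule that processes the jobs on a single machine, without idle time and without preemption starting at time $0$, in nondecreasing order of $d_j$. Then in the EDD schedule every job $j$ completes by time $d_j$, and the total cost $\sum_{j\in\mathcal{J}}f_j(C_j)$ of the EDD schedule (where $C_j$ is the completion time of $j$) is at most $\sum_{j\in\mathcal{J}}\sum_{t\in\mathcal{T}}f_j(t)x_{jt}$.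
   Context: Problem $1||\sum f_j$: jobs are processed one at a time on a single machine; $C_j$ denotes the completion time of job $j$, and the cost of a schedule is $\sum_j f_j(C_j)$. -}

module Defs where

open import Data.Nat using (ℕ; zero; suc; _+_; _*_; _∸_; _⊓_; _≤_; _≤ᵇ_)
open import Data.Bool using (Bool; true; false; if_then_else_)
open import Data.Fin using (Fin; toℕ) renaming (zero to fzero; suc to fsuc)
open import Data.Fin.Subset using (Subset)
open import Data.Fin.Permutation using (Permutation′; _⟨$⟩ʳ_; _⟨$⟩ˡ_)
open import Data.Vec using (lookup)

sumFin : ∀ {n} → (Fin n → ℕ) → ℕ
sumFin {zero}  g = 0
sumFin {suc n} g = g fzero + sumFin (λ i → g (fsuc i))

sumFrom : ℕ → ℕ → (ℕ → ℕ) → ℕ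
sumFrom s zero    g = 0
sumFrom s (suc k) g = g s + sumFrom (suc s) k g

-- Σ_{t=a}^{b} g t  (empty if b < a)
sumRange : ℕ → ℕ → (ℕ → ℕ) → ℕ
sumRange a b g = sumFrom a (suc b ∸ a) g

module _ {n : ℕ} (p : Fin n → ℕ) where

  horizon : ℕ
  horizon = sumFin p

  pOf : Subset n → ℕ
  pOf A = sumFin (λ j → if lookup A j then p j else 0)

  Dt : ℕ → ℕ
  Dt t = suc horizon ∸ t

  -- D(t,A) = max{D(t) - p(A), 0}  (truncated subtraction)
  DtA : ℕ → Subset n → ℕ
  DtA t A = Dt t ∸ pOf A

  pjtA : Fin n → ℕ → Subset n → ℕ
  pjtA j t A = p j ⊓ DtA t A

  -- Schedule given by permutation π : position ↦ job (π ⟨$⟩ʳ position),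
  -- no idle time, no preemption, starting at 0.
  -- Completion time of job j = total processing time of the jobs at
  -- positions ≤ position of j.
  completion : Permutation′ n → Fin n → ℕ
  completion π j =
    sumFin (λ k → if toℕ k ≤ᵇ toℕ (π ⟨$⟩ˡ j) then p (π ⟨$⟩ʳ k) else 0)

-- Let A_j be the set of jobs whose due date d_k exceeds d_j. Each x_k is
-- concentrated at d_k, so in the covering inequality for t = d_j + 1 and A_j no
-- remaining job contributes: D(d_j + 1, A_j) = 0, i.e. the jobs with d_k ≤ d_j
-- have total processing time at most d_j. In the EDD order only such jobs are
-- processed up to j, so C_j ≤ d_j, and monotonicity of f_j gives
-- f_j(C_j) ≤ f_j(d_j) = Σ_t f_j(t) x_jt.
module Submission where

open import Defs
open import Data.Nat using (ℕ; zero; suc; _+_; _*_; _∸_; _≤_; _<_; _≤ᵇ_; _<ᵇ_; _≤?_; _<?_; _≟_; z≤n; s≤s; z<s)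
open import Data.Nat.Properties
open import Data.Bool using (Bool; true; false; T; if_then_else_)
open import Data.Fin using (Fin; toℕ) renaming (zero to fzero; suc to fsuc; _≤_ to _≤ᶠ_)
open import Data.Fin.Subset using (Subset)
open import Data.Fin.Permutation using (Permutation′; _⟨$⟩ʳ_; _⟨$⟩ˡ_; inverseʳ)
open import Data.Vec using (lookup; tabulate)
open import Data.Vec.Properties using (lookup∘tabulate)
open import Data.Product using (_×_; _,_)
open import Relation.Binary.PropositionalEquality using (_≡_; _≢_; refl; sym; trans; cong; cong₂; subst; module ≡-Reasoning)
open import Relation.Nullary using (yes; no; contradiction)
open import Algebra.Properties.CommutativeMonoid.Sum +-0-commutativeMonoid using (sum; sum-permute; ∑-distrib-+)

sumFin≡sum : ∀ {n} (g : Fin n → ℕ) → sumFin g ≡ sum g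
sumFin≡sum {zero}  g = refl
sumFin≡sum {suc n} g = cong (g fzero +_) (sumFin≡sum (λ i → g (fsuc i)))

sumFin-permute : ∀ {n} (g : Fin n → ℕ) (π : Permutation′ n) →
                 sumFin g ≡ sumFin (λ k → g (π ⟨$⟩ʳ k))
sumFin-permute g π = begin
  sumFin g                   ≡⟨ sumFin≡sum g ⟩
  sum g                      ≡⟨ sum-permute g π ⟩
  sum (λ k → g (π ⟨$⟩ʳ k))    ≡⟨ sumFin≡sum (λ k → g (π ⟨$⟩ʳ k)) ⟨
  sumFin (λ k → g (π ⟨$⟩ʳ k)) ∎
  where open ≡-Reasoning

sumFin-distrib-+ : ∀ {n} (g h : Fin n → ℕ) → sumFin (λ i → g i + h i) ≡ sumFin g + sumFin h
sumFin-distrib-+ g h = begin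
  sumFin (λ i → g i + h i) ≡⟨ sumFin≡sum (λ i → g i + h i) ⟩
  sum (λ i → g i + h i)    ≡⟨ ∑-distrib-+ g h ⟩
  sum g + sum h            ≡⟨ cong₂ _+_ (sumFin≡sum g) (sumFin≡sum h) ⟨
  sumFin g + sumFin h      ∎
  where open ≡-Reasoning

sumFin-mono-≤ : ∀ {n} {g h : Fin n → ℕ} → (∀ i → g i ≤ h i) → sumFin g ≤ sumFin h
sumFin-mono-≤ {zero}  g≤h = z≤n
sumFin-mono-≤ {suc n} g≤h = +-mono-≤ (g≤h fzero) (sumFin-mono-≤ (λ i → g≤h (fsuc i)))

≤-sumFin : ∀ {n} (g : Fin n → ℕ) k → g k ≤ sumFin g
≤-sumFin g fzero    = m≤m+n _ _
≤-sumFin g (fsuc k) = ≤-trans (≤-sumFin (λ i → g (fsuc i)) k) (m≤n+m _ _)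

sumFin-zero : ∀ {n} {g : Fin n → ℕ} → (∀ i → g i ≡ 0) → sumFin g ≡ 0
sumFin-zero {zero}  g≡0 = refl
sumFin-zero {suc n} g≡0 rewrite g≡0 fzero = sumFin-zero (λ i → g≡0 (fsuc i))

sumFin-cong : ∀ {n} {g h : Fin n → ℕ} → (∀ i → g i ≡ h i) → sumFin g ≡ sumFin h
sumFin-cong {zero}  g≗h = refl
sumFin-cong {suc n} g≗h = cong₂ _+_ (g≗h fzero) (sumFin-cong (λ i → g≗h (fsuc i)))

sumFin-partition : ∀ {n} (b : Fin n → Bool) (g : Fin n → ℕ) →
                   sumFin (λ i → if b i then g i else 0) + sumFin (λ i → if b i then 0 else g i)
                   ≡ sumFin g
sumFin-partition b g = begin
  sumFin (λ i → if b i then g i else 0) + sumFin (λ i → if b i then 0 else g i)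
    ≡⟨ sumFin-distrib-+ (λ i → if b i then g i else 0) (λ i → if b i then 0 else g i) ⟨
  sumFin (λ i → (if b i then g i else 0) + (if b i then 0 else g i))
    ≡⟨ sumFin-cong (λ i → split (b i) (g i)) ⟩
  sumFin g ∎
  where
  open ≡-Reasoning
  split : ∀ c v → (if c then v else 0) + (if c then 0 else v) ≡ v
  split true  v = +-identityʳ v
  split false v = refl

∈-sumFrom-suc : ∀ {a m c} → a ≢ c → a ≤ c → c < a + suc m → suc a ≤ c × c < suc a + m
∈-sumFrom-suc {a} {m} {c} a≢c a≤c c<a+1+m = ≤∧≢⇒< a≤c a≢c , subst (c <_) (+-suc a m) c<a+1+m

∉-sumFrom-zero : ∀ {a c} → a ≤ c → c < a + 0 → ∀ {A : Set} → A
∉-sumFrom-zero {a} {c} a≤c c<a+0 = contradiction (subst (c <_) (+-identityʳ a) c<a+0) (≤⇒≯ a≤c)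

≤-sumFrom : ∀ a m (g : ℕ → ℕ) {c} → a ≤ c → c < a + m → g c ≤ sumFrom a m g
≤-sumFrom a zero    g a≤c c<a+m = ∉-sumFrom-zero a≤c c<a+m
≤-sumFrom a (suc m) g {c} a≤c c<a+m with a ≟ c
... | yes refl = m≤m+n _ _
... | no  a≢c  with ∈-sumFrom-suc a≢c a≤c c<a+m
...   | a<c , c<a+m′ = ≤-trans (≤-sumFrom (suc a) m g a<c c<a+m′) (m≤n+m _ _)

+-≤-sumFrom : ∀ a m (g : ℕ → ℕ) {c s} → s ≢ c → a ≤ c → c < a + m → a ≤ s → s < a + m →
              g c + g s ≤ sumFrom a m g
+-≤-sumFrom a zero    g _ a≤c c<a+m _ _ = ∉-sumFrom-zero a≤c c<a+m
+-≤-sumFrom a (suc m) g {c} {s} s≢c a≤c c<a+m a≤s s<a+m with a ≟ c | a ≟ s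
... | yes refl | yes refl = contradiction refl s≢c
... | yes refl | no a≢s with ∈-sumFrom-suc a≢s a≤s s<a+m
...   | a<s , s<a+m′ = +-monoʳ-≤ (g a) (≤-sumFrom (suc a) m g a<s s<a+m′)
+-≤-sumFrom a (suc m) g {c} {s} s≢c a≤c c<a+m a≤s s<a+m | no a≢c | yes refl
  with ∈-sumFrom-suc a≢c a≤c c<a+m
... | a<c , c<a+m′ = subst (_≤ sumFrom a (suc m) g) (+-comm (g a) (g c))
                       (+-monoʳ-≤ (g a) (≤-sumFrom (suc a) m g a<c c<a+m′))
+-≤-sumFrom a (suc m) g {c} {s} s≢c a≤c c<a+m a≤s s<a+m | no a≢c | no a≢s
  with ∈-sumFrom-suc a≢c a≤c c<a+m | ∈-sumFrom-suc a≢s a≤s s<a+m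
... | a<c , c<a+m′ | a<s , s<a+m′ =
  ≤-trans (+-≤-sumFrom (suc a) m g s≢c a<c c<a+m′ a<s s<a+m′) (m≤n+m _ _)

sumFrom-zero : ∀ a m (g : ℕ → ℕ) → (∀ s → a ≤ s → s < a + m → g s ≡ 0) → sumFrom a m g ≡ 0
sumFrom-zero a zero    g g≡0 = refl
sumFrom-zero a (suc m) g g≡0 = cong₂ _+_ (g≡0 a ≤-refl (m<m+n a z<s))
  (sumFrom-zero (suc a) m g (λ s a<s s<a+m →
    g≡0 s (<⇒≤ a<s) (subst (s <_) (sym (+-suc a m)) s<a+m)))

∈-sumRange⇒≤ : ∀ {a b s} → a ≤ s → s < a + (suc b ∸ a) → s ≤ b
∈-sumRange⇒≤ {a} {b} {s} a≤s s<a+len with a ≤? suc b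
... | yes a≤1+b = ≤-pred (subst (s <_) (m+[n∸m]≡n a≤1+b) s<a+len)
... | no  a≰1+b =
  ∉-sumFrom-zero a≤s (subst (λ len → s < a + len) (m≤n⇒m∸n≡0 (<⇒≤ (≰⇒> a≰1+b))) s<a+len)

≤⇒∈-sumRange : ∀ {a b s} → a ≤ s → s ≤ b → s < a + (suc b ∸ a)
≤⇒∈-sumRange {a} {b} {s} a≤s s≤b =
  subst (s <_) (sym (m+[n∸m]≡n (≤-trans a≤s (m≤n⇒m≤1+n s≤b)))) (s≤s s≤b)

≤-sumRange : ∀ a b (g : ℕ → ℕ) {c} → a ≤ c → c ≤ b → g c ≤ sumRange a b g
≤-sumRange a b g a≤c c≤b = ≤-sumFrom a (suc b ∸ a) g a≤c (≤⇒∈-sumRange a≤c c≤b)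

sumRange-zero : ∀ a b (g : ℕ → ℕ) → (∀ s → a ≤ s → s ≤ b → g s ≡ 0) → sumRange a b g ≡ 0
sumRange-zero a b g g≡0 =
  sumFrom-zero a (suc b ∸ a) g (λ s a≤s s<a+len → g≡0 s a≤s (∈-sumRange⇒≤ a≤s s<a+len))

sumRange≡1⇒≡0-elsewhere : ∀ a b (g : ℕ → ℕ) {c s} → sumRange a b g ≡ 1 → g c ≡ 1 →
                          a ≤ c → c ≤ b → a ≤ s → s ≤ b → s ≢ c → g s ≡ 0
sumRange≡1⇒≡0-elsewhere a b g {c} {s} Σg≡1 gc≡1 a≤c c≤b a≤s s≤b s≢c =
  n≤0⇒n≡0 (+-cancelˡ-≤ 1 (g s) 0 (begin
    1 + g s          ≡⟨ cong (_+ g s) gc≡1 ⟨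
    g c + g s        ≤⟨ +-≤-sumFrom a (suc b ∸ a) g s≢c
                          a≤c (≤⇒∈-sumRange a≤c c≤b) a≤s (≤⇒∈-sumRange a≤s s≤b) ⟩
    sumRange a b g   ≡⟨ Σg≡1 ⟩
    1                ∎))
  where open ≤-Reasoning

module _ {n} (p : Fin n → ℕ) where

  pOutside : Subset n → ℕ
  pOutside A = sumFin (λ j → if lookup A j then 0 else p j)

  pOf+pOutside≡horizon : ∀ A → pOf p A + pOutside A ≡ horizon p
  pOf+pOutside≡horizon A = sumFin-partition (lookup A) p

  DtA-suc≡0⇒pOutside≤ : ∀ u A → DtA p (suc u) A ≡ 0 → pOutside A ≤ u
  DtA-suc≡0⇒pOutside≤ u A D≡0 = +-cancelˡ-≤ (pOf p A) (pOutside A) u (begin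
    pOf p A + pOutside A   ≡⟨ pOf+pOutside≡horizon A ⟩
    horizon p              ≤⟨ m≤n+m∸n (horizon p) u ⟩
    u + (horizon p ∸ u)    ≤⟨ +-monoʳ-≤ u (m∸n≡0⇒m≤n D≡0) ⟩
    u + pOf p A            ≡⟨ +-comm u (pOf p A) ⟩
    pOf p A + u            ∎)
    where open ≤-Reasoning

  DtA-suc-beyond-horizon : ∀ u A → horizon p ≤ u → DtA p (suc u) A ≡ 0
  DtA-suc-beyond-horizon u A T≤u = trans (cong (_∸ pOf p A) (m≤n⇒m∸n≡0 T≤u)) (0∸n≡0 (pOf p A))

  covering-sum≡0 : ∀ (x : Fin n → ℕ → ℕ) t A →
    (∀ k → lookup A k ≡ false → ∀ s → t ≤ s → s ≤ horizon p → x k s ≡ 0) →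
    sumFin (λ k → if lookup A k then 0
                  else sumRange t (horizon p) (λ s → pjtA p k t A * x k s)) ≡ 0
  covering-sum≡0 x t A vanish = sumFin-zero term≡0
    where
    term≡0 : ∀ k → (if lookup A k then 0
                    else sumRange t (horizon p) (λ s → pjtA p k t A * x k s)) ≡ 0
    term≡0 k with lookup A k in k∉A
    ... | true  = refl
    ... | false = sumRange-zero t (horizon p) _ λ s t≤s s≤T →
      trans (cong (pjtA p k t A *_) (vanish k k∉A s t≤s s≤T)) (*-zeroʳ (pjtA p k t A))

  completion-≤-pOutside : ∀ π j A →
    (∀ k → toℕ k ≤ toℕ (π ⟨$⟩ˡ j) → lookup A (π ⟨$⟩ʳ k) ≡ false) →
    completion p π j ≤ pOutside A
  completion-≤-pOutside π j A early∉A = begin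
    completion p π j                   ≤⟨ sumFin-mono-≤ term≤ ⟩
    sumFin (λ k → outside (π ⟨$⟩ʳ k))  ≡⟨ sumFin-permute outside π ⟨
    pOutside A                         ∎
    where
    open ≤-Reasoning
    outside : Fin n → ℕ
    outside i = if lookup A i then 0 else p i
    term≤ : ∀ k → (if toℕ k ≤ᵇ toℕ (π ⟨$⟩ˡ j) then p (π ⟨$⟩ʳ k) else 0) ≤ outside (π ⟨$⟩ʳ k)
    term≤ k with toℕ k ≤ᵇ toℕ (π ⟨$⟩ˡ j) in k≤?j
    ... | false = z≤n
    ... | true rewrite early∉A k (≤ᵇ⇒≤ _ _ (subst T (sym k≤?j) _)) = ≤-refl

  p≤completion : ∀ π j → p j ≤ completion p π j
  p≤completion π j = begin
    p j                                            ≡⟨ cong p (inverseʳ π) ⟨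
    p (π ⟨$⟩ʳ i)                                   ≡⟨ if-true (≤⇒≤ᵇ (≤-refl {toℕ i})) ⟨
    (if toℕ i ≤ᵇ toℕ i then p (π ⟨$⟩ʳ i) else 0)   ≤⟨ ≤-sumFin _ i ⟩
    completion p π j                               ∎
    where
    open ≤-Reasoning
    i = π ⟨$⟩ˡ j
    if-true : ∀ {b v} → T b → (if b then v else 0) ≡ v
    if-true {true} _ = refl

module _ {n} (d : Fin n → ℕ) where

  later : Fin n → Subset n
  later j = tabulate (λ k → d j <ᵇ d k)

  ∉later⇒≤ : ∀ {j k} → lookup (later j) k ≡ false → d k ≤ d j
  ∉later⇒≤ {j} {k} k∉ =
    ≮⇒≥ λ dj<dk → subst T (trans (sym (lookup∘tabulate _ k)) k∉) (<⇒<ᵇ dj<dk)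

  ≤⇒∉later : ∀ {j k} → d k ≤ d j → lookup (later j) k ≡ false
  ≤⇒∉later {j} {k} dk≤dj rewrite lookup∘tabulate (λ k → d j <ᵇ d k) k with d j <ᵇ d k in dj<?dk
  ... | true  = contradiction (<ᵇ⇒< (d j) (d k) (subst T (sym dj<?dk) _)) (≤⇒≯ dk≤dj)
  ... | false = refl

  EDD-completion-≤ : ∀ (p : Fin n → ℕ) (π : Permutation′ n) →
    (∀ i k → i ≤ᶠ k → d (π ⟨$⟩ʳ i) ≤ d (π ⟨$⟩ʳ k)) →
    ∀ j → completion p π j ≤ pOutside p (later j)
  EDD-completion-≤ p π sorted j = completion-≤-pOutside p π j (later j) λ k k≤j →
    ≤⇒∉later (subst (λ i → d (π ⟨$⟩ʳ k) ≤ d i) (inverseʳ π) (sorted k (π ⟨$⟩ˡ j) k≤j))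

lemma4 : (n : ℕ) (p : Fin n → ℕ) (f : Fin n → ℕ → ℕ) (x : Fin n → ℕ → ℕ)
    → (∀ j → 1 ≤ p j)
    → (∀ j a b → 1 ≤ a → a ≤ b → f j a ≤ f j b)
    → (∀ j t → 1 ≤ t → t ≤ horizon p → x j t ≤ 1)
    → (∀ t → 1 ≤ t → t ≤ horizon p → (A : Subset n)
         → DtA p t A ≤ sumFin (λ j → if lookup A j then 0
              else sumRange t (horizon p) (λ s → pjtA p j t A * x j s)))
    → (∀ j → sumRange 1 (horizon p) (x j) ≡ 1)
    → (d : Fin n → ℕ)
    → (∀ j → 1 ≤ d j × d j ≤ horizon p × x j (d j) ≡ 1)
    → (π : Permutation′ n)
    → (∀ i k → i ≤ᶠ k → d (π ⟨$⟩ʳ i) ≤ d (π ⟨$⟩ʳ k))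
    → (∀ j → completion p π j ≤ d j)
      × sumFin (λ j → f j (completion p π j))
        ≤ sumFin (λ j → sumRange 1 (horizon p) (λ t → f j t * x j t))
lemma4 n p f x p≥1 f-mono _ covering Σx≡1 d due π sorted = meets-due , cost-bound
  where
  x-off-due : ∀ k s → 1 ≤ s → s ≤ horizon p → s ≢ d k → x k s ≡ 0
  x-off-due k s 1≤s s≤T s≢dk with due k
  ... | 1≤dk , dk≤T , x≡1 =
    sumRange≡1⇒≡0-elsewhere 1 (horizon p) (x k) (Σx≡1 k) x≡1 1≤dk dk≤T 1≤s s≤T s≢dk

  D-later≡0 : ∀ j → DtA p (suc (d j)) (later d j) ≡ 0
  D-later≡0 j with d j <? horizon p
  ... | no  dj≮T = DtA-suc-beyond-horizon p (d j) (later d j) (≮⇒≥ dj≮T)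
  ... | yes dj<T = n≤0⇒n≡0 (subst (DtA p (suc (d j)) (later d j) ≤_)
                     (covering-sum≡0 p x (suc (d j)) (later d j) vanish)
                     (covering (suc (d j)) (s≤s z≤n) dj<T (later d j)))
    where
    vanish : ∀ k → lookup (later d j) k ≡ false → ∀ s → suc (d j) ≤ s → s ≤ horizon p → x k s ≡ 0
    vanish k k∉ s dj<s s≤T = x-off-due k s (≤-trans (s≤s z≤n) dj<s) s≤T
      λ s≡dk → <⇒≱ dj<s (subst (_≤ d j) (sym s≡dk) (∉later⇒≤ d k∉))

  meets-due : ∀ j → completion p π j ≤ d j
  meets-due j = ≤-trans (EDD-completion-≤ d p π sorted j)
                        (DtA-suc≡0⇒pOutside≤ p (d j) (later d j) (D-later≡0 j))

  cost-bound : sumFin (λ j → f j (completion p π j))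
               ≤ sumFin (λ j → sumRange 1 (horizon p) (λ t → f j t * x j t))
  cost-bound = sumFin-mono-≤ λ j → let (1≤dj , dj≤T , x≡1) = due j in begin
    f j (completion p π j)   ≤⟨ f-mono j _ _ (≤-trans (p≥1 j) (p≤completion p π j)) (meets-due j) ⟩
    f j (d j)                ≡⟨ *-identityʳ (f j (d j)) ⟨
    f j (d j) * 1            ≡⟨ cong (f j (d j) *_) x≡1 ⟨
    f j (d j) * x j (d j)    ≤⟨ ≤-sumRange 1 (horizon p) (λ t → f j t * x j t) 1≤dj dj≤T ⟩
    sumRange 1 (horizon p) (λ t → f j t * x j t) ∎
    where open ≤-Reasoning
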